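{- Let $T$ be a tree of order $n$ with $m = n-1$ edges, degree sequence $\mathscr{D} = (d_1, \dots, d_n)$ with $d_1 \leqslant \dots \leqslant d_n$, and maximum degree $\Delta$, and let $\lambda_{\mathscr{D}}$ be the average of the entries of $\mathscr{D}$. Then \[ \sigma(T) \geqslant \frac{1}{3} \lambda_{\mathscr{D}}^2 \left( \left\lfloor \frac{3n+1}{2} \right\rfloor + \left\lceil \frac{3m+1}{2} \right\rceil + \left\lfloor \frac{3\Delta + 2n}{4} \right\rfloor \right) - \sum_{v \in V(T)} \deg_T(v)^3 + \operatorname{irr}(T). \]
   Context: For a graph $G$, the Albertson index is $\operatorname{irr}(G) = \sum_{uv \in E(G)} |\deg_G(u) - \deg_G(v)|$ and the Sigma index is $\sigma(G) = \sum_{uv \in E(G)} (\deg_G(u) - \deg_G(v))^2$. -}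

module Defs where

open import Data.Nat as ℕ using (ℕ; zero; suc; _+_; _*_; _≤_; _⊔_; ∣_-_∣)
open import Data.Bool using (Bool; true; false; if_then_else_)
open import Data.Fin using (Fin; toℕ)
open import Data.Nat.ListAction using (sum)
open import Data.List using (List; []; _∷_; map; foldr; length; _++_; [_])
open import Data.List.Relation.Unary.Linked using (Linked)
open import Data.List.Relation.Unary.Unique.Propositional using (Unique)
open import Data.Product using (_×_)
open import Data.Empty using (⊥)
open import Relation.Nullary using (¬_)
open import Relation.Binary.PropositionalEquality using (_≡_)
open import Data.Fin using () renaming (_<?_ to _<ᶠ?_)
open import Relation.Nullary.Decidable using (does)

open import Data.List using (allFin) public

record Graph (n : ℕ) : Set where
  field
    adj   : Fin n → Fin n → Bool
    sym   : ∀ u v → adj u v ≡ adj v u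
    irrefl : ∀ u → adj u u ≡ false
open Graph public

Adj : ∀ {n} → Graph n → Fin n → Fin n → Set
Adj G u v = adj G u v ≡ true

data Walk {n} (G : Graph n) : Fin n → Fin n → Set where
  here : ∀ {u} → Walk G u u
  step : ∀ {u v w} → Adj G u v → Walk G v w → Walk G u w

Connected : ∀ {n} → Graph n → Set
Connected G = ∀ u v → Walk G u v

IsCycle : ∀ {n} → Graph n → List (Fin n) → Set
IsCycle G [] = ⊥
IsCycle G (x ∷ xs) =
  (3 ≤ length (x ∷ xs)) × Unique (x ∷ xs) × Linked (Adj G) ((x ∷ xs) ++ [ x ])

Acyclic : ∀ {n} → Graph n → Set
Acyclic G = ∀ c → ¬ IsCycle G c

IsTree : ∀ {n} → Graph n → Set
IsTree G = Connected G × Acyclic G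

Σv : ∀ {n} → (Fin n → ℕ) → ℕ
Σv {n} f = sum (map f (allFin n))

deg : ∀ {n} → Graph n → Fin n → ℕ
deg G u = Σv (λ v → if adj G u v then 1 else 0)

maxDeg : ∀ {n} → Graph n → ℕ
maxDeg {n} G = foldr _⊔_ 0 (map (deg G) (allFin n))

-- sum over edges uv (each unordered edge once: toℕ u < toℕ v)
Σe : ∀ {n} → Graph n → (Fin n → Fin n → ℕ) → ℕ
Σe G f = Σv (λ u → Σv (λ v → if does (u <ᶠ? v) then (if adj G u v then f u v else 0) else 0))

edgeCount : ∀ {n} → Graph n → ℕ
edgeCount G = Σe G (λ _ _ → 1)

irr : ∀ {n} → Graph n → ℕ
irr G = Σe G (λ u v → ∣ deg G u - deg G v ∣)

sigma : ∀ {n} → Graph n → ℕ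
sigma G = Σe G (λ u v → ∣ deg G u - deg G v ∣ * ∣ deg G u - deg G v ∣)

{-# OPTIONS --safe #-}
module Submission where

-- Write S = Σ deg, F = Σ deg³ and K for the bracket, so λ = S / n. The right-hand side
-- is at most irr T ≤ σ T (as x ≤ x² on ℕ) because λ² K / 3 ≤ F: on the one hand K ≤ 3S,
-- from the floor and ceiling bounds together with S = 2m, Δ + (n − 1) ≤ S and S ≥ n + 1
-- for n ≥ 3 (a connected graph on at least three vertices has a vertex of degree ≥ 2);
-- on the other hand S³ ≤ n² F, the power-mean inequality, obtained by summing
-- 3S²y ≤ y³ + 2S³ over y = n · deg v.

module SumMap where

  open import Data.Nat
  open import Data.Nat.Properties
  open import Data.Nat.ListAction using (sum)
  open import Data.List using (List; []; _∷_; map; length; foldr)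
  open import Data.List.Membership.Propositional using (_∈_)
  open import Data.List.Relation.Unary.Any using (here; there)
  open import Relation.Binary.PropositionalEquality
  open import Data.Empty using (⊥-elim)
  open import Function using (_∘_)
  open import Data.Nat.Tactic.RingSolver using (solve-∀)

  private
    variable
      A B : Set

  sum-map-+ : ∀ (f g : A → ℕ) xs →
              sum (map (λ x → f x + g x) xs) ≡ sum (map f xs) + sum (map g xs)
  sum-map-+ f g []       = refl
  sum-map-+ f g (x ∷ xs) = begin
    f x + g x + sum (map (λ x → f x + g x) xs)         ≡⟨ cong (f x + g x +_) (sum-map-+ f g xs) ⟩
    f x + g x + (sum (map f xs) + sum (map g xs))     ≡⟨ interchange (f x) (g x) _ _ ⟩
    f x + sum (map f xs) + (g x + sum (map g xs))     ∎
    where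
    open ≡-Reasoning
    interchange : ∀ a b c d → a + b + (c + d) ≡ a + c + (b + d)
    interchange = solve-∀

  sum-map-*ˡ : ∀ c (f : A → ℕ) xs → sum (map (λ x → c * f x) xs) ≡ c * sum (map f xs)
  sum-map-*ˡ c f []       = sym (*-zeroʳ c)
  sum-map-*ˡ c f (x ∷ xs) =
    trans (cong (c * f x +_) (sum-map-*ˡ c f xs)) (sym (*-distribˡ-+ c (f x) _))

  sum-map-const : ∀ c (xs : List A) → sum (map (λ _ → c) xs) ≡ length xs * c
  sum-map-const c []       = refl
  sum-map-const c (x ∷ xs) = cong (c +_) (sum-map-const c xs)

  sum-map-mono-≤ : ∀ {f g : A → ℕ} → (∀ x → f x ≤ g x) → ∀ xs → sum (map f xs) ≤ sum (map g xs)
  sum-map-mono-≤ f≤g []       = z≤n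
  sum-map-mono-≤ f≤g (x ∷ xs) = +-mono-≤ (f≤g x) (sum-map-mono-≤ f≤g xs)

  sum-map-comm : ∀ (f : A → B → ℕ) xs ys →
                 sum (map (λ x → sum (map (f x) ys)) xs) ≡ sum (map (λ y → sum (map (λ x → f x y) xs)) ys)
  sum-map-comm f []       ys = sym (trans (sum-map-const 0 ys) (*-zeroʳ (length ys)))
  sum-map-comm f (x ∷ xs) ys = trans (cong (sum (map (f x) ys) +_) (sum-map-comm f xs ys))
                                     (sym (sum-map-+ (f x) (λ y → sum (map (λ x → f x y) xs)) ys))

  ∈⇒≤sum-map : ∀ (f : A → ℕ) {x xs} → x ∈ xs → f x ≤ sum (map f xs)
  ∈⇒≤sum-map f {xs = y ∷ ys} (here refl) = m≤m+n (f y) _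
  ∈⇒≤sum-map f {xs = y ∷ ys} (there x∈ys) = ≤-trans (∈⇒≤sum-map f x∈ys) (m≤n+m _ (f y))

  ∈-≢-∈⇒+≤sum-map : ∀ (f : A → ℕ) {x y xs} → x ∈ xs → y ∈ xs → x ≢ y → f x + f y ≤ sum (map f xs)
  ∈-≢-∈⇒+≤sum-map f (here refl)  (here refl)  x≢y = ⊥-elim (x≢y refl)
  ∈-≢-∈⇒+≤sum-map f (here refl)  (there y∈zs) _   = +-monoʳ-≤ (f _) (∈⇒≤sum-map f y∈zs)
  ∈-≢-∈⇒+≤sum-map f {x} {xs = z ∷ zs} (there x∈zs) (here refl) _ =
    subst (_≤ f z + sum (map f zs)) (+-comm (f z) (f x)) (+-monoʳ-≤ (f z) (∈⇒≤sum-map f x∈zs))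
  ∈-≢-∈⇒+≤sum-map f {xs = z ∷ _} (there x∈zs) (there y∈zs) x≢y =
    ≤-trans (∈-≢-∈⇒+≤sum-map f x∈zs y∈zs x≢y) (m≤n+m _ (f z))

  module _ (f : A → ℕ) (1≤f : ∀ x → 1 ≤ f x) where

    length≤sum-map : ∀ xs → length xs ≤ sum (map f xs)
    length≤sum-map []       = z≤n
    length≤sum-map (x ∷ xs) = +-mono-≤ (1≤f x) (length≤sum-map xs)

    ∈⇒+length≤suc-sum-map : ∀ {x} xs → x ∈ xs → f x + length xs ≤ suc (sum (map f xs))
    ∈⇒+length≤suc-sum-map (y ∷ ys) (here refl) = begin
      f y + suc (length ys)        ≡⟨ +-suc (f y) (length ys) ⟩
      suc (f y + length ys)        ≤⟨ s≤s (+-monoʳ-≤ (f y) (length≤sum-map ys)) ⟩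
      suc (f y + sum (map f ys))   ∎
      where open ≤-Reasoning
    ∈⇒+length≤suc-sum-map {x} (y ∷ ys) (there x∈ys) = begin
      f x + suc (length ys)        ≡⟨ +-suc (f x) (length ys) ⟩
      suc (f x + length ys)        ≤⟨ s≤s (∈⇒+length≤suc-sum-map ys x∈ys) ⟩
      suc (suc (sum (map f ys)))   ≤⟨ s≤s (+-monoˡ-≤ _ (1≤f y)) ⟩
      suc (f y + sum (map f ys))   ∎
      where open ≤-Reasoning

  foldr-⊔-map-+-lub : ∀ (f : A → ℕ) c {b} xs → c ≤ b → (∀ {x} → x ∈ xs → f x + c ≤ b) →
                      foldr _⊔_ 0 (map f xs) + c ≤ b
  foldr-⊔-map-+-lub f c []       c≤b _   = c≤b
  foldr-⊔-map-+-lub f c {b} (x ∷ xs) c≤b f≤ = begin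
    f x ⊔ foldr _⊔_ 0 (map f xs) + c          ≡⟨ +-distribʳ-⊔ c (f x) _ ⟩
    (f x + c) ⊔ (foldr _⊔_ 0 (map f xs) + c)  ≤⟨ ⊔-lub (f≤ (here refl)) (foldr-⊔-map-+-lub f c xs c≤b (f≤ ∘ there)) ⟩
    b                                         ∎
    where
    open ≤-Reasoning

module PowerMean where

  open import Data.Nat
  open import Data.Nat.Properties
  open import Data.Nat.ListAction using (sum)
  open import Data.List using (map; length)
  open import Data.List.Properties using (map-cong)
  open import Data.Sum using (inj₁; inj₂)
  open import Data.Product using (_,_)
  open import Function using (_∘_)
  open import Relation.Binary.PropositionalEquality
  open import Data.Nat.Tactic.RingSolver using (solve-∀)
  open SumMap

  cube : ℕ → ℕ
  cube x = x * x * x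

  -- y³ + 2S³ − 3S²y = (y − S)²(y + 2S)
  3*S²*y≤y³+2*S³ : ∀ S y → 3 * (S * S) * y ≤ cube y + 2 * cube S
  3*S²*y≤y³+2*S³ S y with ≤-total y S
  ... | inj₁ y≤S with a , refl ← m≤n⇒∃[o]m+o≡n y≤S =
    ≤-trans (m≤m+n _ (3 * y * a * a + 2 * (a * a * a))) (≤-reflexive (expand y a))
    where
    expand : ∀ y a → 3 * ((y + a) * (y + a)) * y + (3 * y * a * a + 2 * (a * a * a))
                   ≡ y * y * y + 2 * ((y + a) * (y + a) * (y + a))
    expand = solve-∀
  ... | inj₂ S≤y with a , refl ← m≤n⇒∃[o]m+o≡n S≤y =
    ≤-trans (m≤m+n _ (3 * S * a * a + a * a * a)) (≤-reflexive (expand S a))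
    where
    expand : ∀ S a → 3 * (S * S) * (S + a) + (3 * S * a * a + a * a * a)
                   ≡ (S + a) * (S + a) * (S + a) + 2 * (S * S * S)
    expand = solve-∀

  cube[sum]≤sum[cube]*length² : ∀ {A : Set} (f : A → ℕ) xs → 1 ≤ length xs →
                                cube (sum (map f xs)) ≤ sum (map (cube ∘ f) xs) * (length xs * length xs)
  cube[sum]≤sum[cube]*length² f xs 1≤L =
    *-cancelˡ-≤ L {{>-nonZero 1≤L}} (+-cancelʳ-≤ (2 * (L * cube S)) _ _ (begin
      L * cube S + 2 * (L * cube S)                          ≡⟨ collect L S ⟩
      3 * (S * S) * L * S                                    ≡⟨ sum-map-scale (3 * (S * S)) L f ⟨
      sum (map (λ x → 3 * (S * S) * (L * f x)) xs)          ≤⟨ sum-map-mono-≤ (λ x → 3*S²*y≤y³+2*S³ S (L * f x)) xs ⟩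
      sum (map (λ x → cube (L * f x) + 2 * cube S) xs)      ≡⟨ sum-map-+ (λ x → cube (L * f x)) (λ _ → 2 * cube S) xs ⟩
      sum (map (λ x → cube (L * f x)) xs) + sum (map (λ _ → 2 * cube S) xs)
        ≡⟨ cong₂ _+_ (sum-map-cube-scale L f) (sum-map-const (2 * cube S) xs) ⟩
      cube L * F + L * (2 * cube S)                          ≡⟨ regroup L S F ⟩
      L * (F * (L * L)) + 2 * (L * cube S)                   ∎))
    where
    open ≤-Reasoning
    L = length xs
    S = sum (map f xs)
    F = sum (map (cube ∘ f) xs)
    sum-map-scale : ∀ c d (g : _ → ℕ) → sum (map (λ x → c * (d * g x)) xs) ≡ c * d * sum (map g xs)
    sum-map-scale c d g = trans (cong sum (map-cong (λ x → sym (*-assoc c d (g x))) xs)) (sum-map-*ˡ (c * d) g xs)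
    sum-map-cube-scale : ∀ c (g : _ → ℕ) → sum (map (λ x → cube (c * g x)) xs) ≡ cube c * sum (map (cube ∘ g) xs)
    sum-map-cube-scale c g = trans (cong sum (map-cong (λ x → cube-* c (g x)) xs)) (sum-map-*ˡ (cube c) (cube ∘ g) xs)
      where
      cube-* : ∀ a b → (a * b) * (a * b) * (a * b) ≡ (a * a * a) * (b * b * b)
      cube-* = solve-∀
    collect : ∀ L S → L * (S * S * S) + 2 * (L * (S * S * S)) ≡ 3 * (S * S) * L * S
    collect = solve-∀
    regroup : ∀ L S F → L * L * L * F + L * (2 * (S * S * S)) ≡ L * (F * (L * L)) + 2 * (L * (S * S * S))
    regroup = solve-∀

module Degrees where

  open import Defs renaming (sym to adj-sym)
  open import Data.Nat
  open import Data.Nat.Properties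
  open import Data.Nat.ListAction using (sum)
  open import Data.Bool using (true; false; if_then_else_)
  open import Data.Fin as Fin using (Fin; zero; suc)
  import Data.Fin.Properties as Fin
  open import Data.List using (length; allFin)
  open import Data.List.Properties using (length-tabulate; map-cong)
  open import Data.List.Membership.Propositional.Properties using (∈-allFin)
  open import Data.Sum using (_⊎_; inj₁; inj₂)
  open import Data.Product using (∃; _×_; _,_; proj₂)
  open import Relation.Binary.PropositionalEquality
  open import Relation.Binary.Definitions using (tri<; tri≈; tri>)
  open import Relation.Nullary using (¬_; does; yes; no; contradiction)
  open import Relation.Nullary.Decidable using (dec-true; dec-false)
  open import Function using (_∘_)
  open SumMap
  open PowerMean

  length-allFin : ∀ n → length (allFin n) ≡ n
  length-allFin n = length-tabulate (λ v → v)

  cube[Σv]≤Σv[cube]*n² : ∀ {n} .{{_ : NonZero n}} (f : Fin n → ℕ) → cube (Σv f) ≤ Σv (cube ∘ f) * (n * n)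
  cube[Σv]≤Σv[cube]*n² {n} f = subst (λ L → cube (Σv f) ≤ Σv (cube ∘ f) * (L * L)) (length-allFin n)
    (cube[sum]≤sum[cube]*length² f (allFin n) (subst (1 ≤_) (sym (length-allFin n)) (>-nonZero⁻¹ n)))

  module _ {n : ℕ} (G : Graph n) where

    [adj] : Fin n → Fin n → ℕ
    [adj] u v = if adj G u v then 1 else 0

    [u<v∧adj] : Fin n → Fin n → ℕ
    [u<v∧adj] u v = if does (u Fin.<? v) then [adj] u v else 0

    [adj]≡[u<v∧adj]+[v<u∧adj] : ∀ u v → [adj] u v ≡ [u<v∧adj] u v + [u<v∧adj] v u
    [adj]≡[u<v∧adj]+[v<u∧adj] u v with Fin.<-cmp u v
    ... | tri< u<v _ v≮u rewrite dec-true (u Fin.<? v) u<v | dec-false (v Fin.<? u) v≮u =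
      sym (+-identityʳ _)
    ... | tri≈ u≮u refl _ rewrite dec-false (u Fin.<? u) u≮u | irrefl G u = refl
    ... | tri> u≮v _ v<u rewrite dec-false (u Fin.<? v) u≮v | dec-true (v Fin.<? u) v<u | adj-sym G u v =
      refl

    handshake : Σv (deg G) ≡ 2 * edgeCount G
    handshake = begin
      Σv (λ u → Σv ([adj] u))
        ≡⟨ cong sum (map-cong (λ u → cong sum (map-cong ([adj]≡[u<v∧adj]+[v<u∧adj] u) vs)) vs) ⟩
      Σv (λ u → Σv (λ v → [u<v∧adj] u v + [u<v∧adj] v u))
        ≡⟨ cong sum (map-cong (λ u → sum-map-+ ([u<v∧adj] u) (λ v → [u<v∧adj] v u) vs) vs) ⟩
      Σv (λ u → Σv ([u<v∧adj] u) + Σv (λ v → [u<v∧adj] v u))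
        ≡⟨ sum-map-+ _ _ vs ⟩
      edgeCount G + Σv (λ u → Σv (λ v → [u<v∧adj] v u))
        ≡⟨ cong (edgeCount G +_) (sym (sum-map-comm [u<v∧adj] vs vs)) ⟩
      edgeCount G + edgeCount G
        ≡⟨ cong (edgeCount G +_) (sym (+-identityʳ _)) ⟩
      2 * edgeCount G ∎
      where
      open ≡-Reasoning
      vs = allFin n

    Σe-mono-≤ : ∀ {f g : Fin n → Fin n → ℕ} → (∀ u v → f u v ≤ g u v) → Σe G f ≤ Σe G g
    Σe-mono-≤ f≤g = sum-map-mono-≤ (λ u → sum-map-mono-≤ (λ v →
        if-mono (does (u Fin.<? v)) (if-mono (adj G u v) (f≤g u v))) (allFin n)) (allFin n)
      where
      if-mono : ∀ b {x y} → x ≤ y → (if b then x else 0) ≤ (if b then y else 0)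
      if-mono true  x≤y = x≤y
      if-mono false _   = z≤n

    irr≤sigma : irr G ≤ sigma G
    irr≤sigma = Σe-mono-≤ (λ u v → m≤m*m ∣ deg G u - deg G v ∣)
      where
      m≤m*m : ∀ m → m ≤ m * m
      m≤m*m zero    = z≤n
      m≤m*m (suc m) = m≤m*n (suc m) (suc m)

    Adj⇒1≤deg : ∀ {u v} → Adj G u v → 1 ≤ deg G u
    Adj⇒1≤deg {u} {v} uv =
      subst (_≤ deg G u) (cong (λ b → if b then 1 else 0) uv) (∈⇒≤sum-map ([adj] u) (∈-allFin v))

    Adj-Adj-≢⇒2≤deg : ∀ {u v w} → Adj G u v → Adj G u w → v ≢ w → 2 ≤ deg G u
    Adj-Adj-≢⇒2≤deg {u} {v} {w} uv uw v≢w =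
      subst (_≤ deg G u) (cong₂ (λ b c → (if b then 1 else 0) + (if c then 1 else 0)) uv uw)
        (∈-≢-∈⇒+≤sum-map ([adj] u) (∈-allFin v) (∈-allFin w) v≢w)

    Walk⇒Adj : ∀ {u w} → Walk G u w → u ≢ w → ∃ (Adj G u)
    Walk⇒Adj here         u≢u = contradiction refl u≢u
    Walk⇒Adj (step uv _) _   = _ , uv

    deg≤1⇒Walk⇒≡⊎Adj : (∀ v → deg G v ≤ 1) → ∀ {u w} → Walk G u w → u ≡ w ⊎ Adj G u w
    deg≤1⇒Walk⇒≡⊎Adj deg≤1 here = inj₁ refl
    deg≤1⇒Walk⇒≡⊎Adj deg≤1 {u} {w} (step {v = v} uv vw) with deg≤1⇒Walk⇒≡⊎Adj deg≤1 vw
    ... | inj₁ refl = inj₂ uv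
    ... | inj₂ vw′ with u Fin.≟ w
    ...   | yes u≡w = inj₁ u≡w
    ...   | no  u≢w = contradiction (deg≤1 v) (<⇒≱ (Adj-Adj-≢⇒2≤deg (trans (adj-sym G v u) uv) vw′ u≢w))

    module _ (1≤deg : ∀ v → 1 ≤ deg G v) where

      deg+n≤1+Σdeg : ∀ v → deg G v + n ≤ suc (Σv (deg G))
      deg+n≤1+Σdeg v = subst (λ L → deg G v + L ≤ suc (Σv (deg G))) (length-allFin n)
        (∈⇒+length≤suc-sum-map (deg G) 1≤deg (allFin n) (∈-allFin v))

      maxDeg+n≤1+Σdeg : maxDeg G + n ≤ suc (Σv (deg G))
      maxDeg+n≤1+Σdeg = foldr-⊔-map-+-lub (deg G) n (allFin n) n≤1+Σdeg (λ {v} _ → deg+n≤1+Σdeg v)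
        where
        n≤1+Σdeg : n ≤ suc (Σv (deg G))
        n≤1+Σdeg = subst (_≤ suc (Σv (deg G))) (length-allFin n)
          (m≤n⇒m≤1+n (length≤sum-map (deg G) 1≤deg (allFin n)))

      2≤deg⇒n<Σdeg : ∀ {v} → 2 ≤ deg G v → n < Σv (deg G)
      2≤deg⇒n<Σdeg {v} 2≤deg = s≤s⁻¹ (≤-trans (+-monoˡ-≤ n 2≤deg) (deg+n≤1+Σdeg v))

  connected⇒1≤deg : ∀ {n} (G : Graph (2 + n)) → Connected G → ∀ v → 1 ≤ deg G v
  connected⇒1≤deg G conn zero    = Adj⇒1≤deg G (proj₂ (Walk⇒Adj G (conn zero (suc zero)) (λ ())))
  connected⇒1≤deg G conn (suc v) = Adj⇒1≤deg G (proj₂ (Walk⇒Adj G (conn (suc v) zero) (λ ())))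

  connected⇒¬deg≤1 : ∀ {n} (G : Graph (3 + n)) → Connected G → ¬ (∀ v → deg G v ≤ 1)
  connected⇒¬deg≤1 G conn deg≤1
    with deg≤1⇒Walk⇒≡⊎Adj G deg≤1 (conn zero (suc zero)) | deg≤1⇒Walk⇒≡⊎Adj G deg≤1 (conn zero (suc (suc zero)))
  ... | inj₁ () | _
  ... | inj₂ _  | inj₁ ()
  ... | inj₂ a  | inj₂ b = contradiction (deg≤1 zero) (<⇒≱ (Adj-Adj-≢⇒2≤deg G a b (λ ())))

  connected⇒n<Σdeg : ∀ {n} (G : Graph (3 + n)) → Connected G → 3 + n < Σv (deg G)
  connected⇒n<Σdeg {n} G conn with v , deg≰1 ← Fin.¬∀⟶∃¬ (3 + n) _ (λ v → deg G v ≤? 1) (connected⇒¬deg≤1 G conn) =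
    2≤deg⇒n<Σdeg G (connected⇒1≤deg G conn) (≰⇒> deg≰1)

  connected⇒Σdeg≡2 : (G : Graph 2) → Connected G → Σv (deg G) ≡ 2
  connected⇒Σdeg≡2 G conn with Walk⇒Adj G (conn zero (suc zero)) (λ ())
  ... | zero     , 0~0 = contradiction (trans (sym 0~0) (irrefl G zero)) (λ ())
  ... | suc zero , 0~1 rewrite irrefl G zero | irrefl G (suc zero) | adj-sym G (suc zero) zero | 0~1 = refl

  connected⇒n<Σdeg⊎n≡Σdeg≡2 : ∀ {n} (G : Graph (2 + n)) → Connected G →
                               2 + n < Σv (deg G) ⊎ (2 + n ≡ 2 × Σv (deg G) ≡ 2)
  connected⇒n<Σdeg⊎n≡Σdeg≡2 {zero}  G conn = inj₂ (refl , connected⇒Σdeg≡2 G conn)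
  connected⇒n<Σdeg⊎n≡Σdeg≡2 {suc n} G conn = inj₁ (connected⇒n<Σdeg G conn)

module FloorCeiling where

  open import Data.Nat as ℕ using (ℕ)
  import Data.Nat.Properties as ℕ
  import Data.Nat.GCD as ℕ
  open import Data.Integer
  open import Data.Integer.Properties
  open import Data.Integer.DivMod using ([n/d]*d≤n; n<s[n/ℕd]*d; div-pos-is-/ℕ)
  open import Data.Integer.GCD using (gcd)
  open import Data.Rational as ℚ using (mkℚ; ↥_; ↧_; floor; ceiling)
  import Data.Rational.Properties as ℚ
  open import Relation.Binary.PropositionalEquality
  open import Data.Integer.Tactic.RingSolver using (solve-∀)

  floor*↧≤↥ : ∀ p → floor p * ↧ p ≤ ↥ p
  floor*↧≤↥ p@record{} = [n/d]*d≤n (↥ p) (↧ p)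

  ↥<suc[floor]*↧ : ∀ p → ↥ p < suc (floor p) * ↧ p
  ↥<suc[floor]*↧ (mkℚ i d _) =
    subst (λ f → i < suc f * + ℕ.suc d) (sym (div-pos-is-/ℕ i (ℕ.suc d))) (n<s[n/ℕd]*d i (ℕ.suc d))

  ceiling*↧<↥+↧ : ∀ p → ceiling p * ↧ p < ↥ p + ↧ p
  ceiling*↧<↥+↧ p@record{} = begin-strict
    - f * ↧ p                  ≡⟨ rearrange f (↧ p) ⟩
    - (↧ p + f * ↧ p) + ↧ p    <⟨ +-monoˡ-< (↧ p) (neg-mono-< -↥p<↧p+f*↧p) ⟩
    - - ↥ p + ↧ p              ≡⟨ cong (_+ ↧ p) (neg-involutive (↥ p)) ⟩
    ↥ p + ↧ p                  ∎
    where
    open ≤-Reasoning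
    f = floor (ℚ.- p)
    -↥p<↧p+f*↧p : - ↥ p < ↧ p + f * ↧ p
    -↥p<↧p+f*↧p = subst (- ↥ p <_) (suc-* f (↧ p))
      (subst₂ (λ a b → a < suc f * b) (ℚ.↥-neg p) (ℚ.↧-neg p) (↥<suc[floor]*↧ (ℚ.- p)))
    rearrange : ∀ f d → - f * d ≡ - (d + f * d) + d
    rearrange = solve-∀

  module _ (i : ℤ) (d : ℕ) where

    private
      n = ℕ.suc d
      q = i ℚ./ n
      g = gcd i (+ n)
      instance
        g-positive : Positive g
        g-positive = positive (+<+ (ℕ.n≢0⇒n>0 (λ g≡0 → ℕ.1+n≢0 (ℕ.gcd[m,n]≡0⇒n≡0 ∣ i ∣ g≡0))))

    floor[i/n]*n≤i : floor q * + n ≤ i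
    floor[i/n]*n≤i = begin
      floor q * + n          ≡⟨ cong (floor q *_) (ℚ.↧-/ i n) ⟨
      floor q * (↧ q * g)    ≡⟨ *-assoc (floor q) (↧ q) g ⟨
      floor q * ↧ q * g      ≤⟨ *-monoʳ-≤-nonNeg g (floor*↧≤↥ q) ⟩
      ↥ q * g                ≡⟨ ℚ.↥-/ i n ⟩
      i                      ∎
      where open ≤-Reasoning

    ceiling[i/n]*n<i+n : ceiling q * + n < i + + n
    ceiling[i/n]*n<i+n = begin-strict
      ceiling q * + n          ≡⟨ cong (ceiling q *_) (ℚ.↧-/ i n) ⟨
      ceiling q * (↧ q * g)    ≡⟨ *-assoc (ceiling q) (↧ q) g ⟨
      ceiling q * ↧ q * g      <⟨ *-monoʳ-<-pos g (ceiling*↧<↥+↧ q) ⟩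
      (↥ q + ↧ q) * g          ≡⟨ *-distribʳ-+ g (↥ q) (↧ q) ⟩
      ↥ q * g + ↧ q * g        ≡⟨ cong₂ _+_ (ℚ.↥-/ i n) (ℚ.↧-/ i n) ⟩
      i + + n                  ∎
      where open ≤-Reasoning

module Bracket where

  open import Data.Nat
  open import Data.Nat.Properties
  open import Data.Nat.DivMod using (m/n*n≤m; /-monoˡ-≤; m*n/n≡m)
  open import Data.Integer as ℤ using (ℤ; +_; +≤+; -≤+; -[1+_])
  import Data.Integer.Properties as ℤ
  open import Data.Rational as ℚ using (floor; ceiling)
  open import Data.Sum using (_⊎_; inj₁; inj₂)
  open import Data.Product using (_×_; _,_)
  open import Relation.Binary.PropositionalEquality
  open import Data.Nat.Tactic.RingSolver using (solve-∀)
  open import Defs using (Graph; Connected; irrefl; Σv; deg; edgeCount; maxDeg)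
  open import Data.Fin using (zero)
  open FloorCeiling
  open Degrees

  bracket : ℕ → ℕ → ℕ → ℤ
  bracket n m Δ =
    floor (+ (3 * n + 1) ℚ./ 2) ℤ.+ ceiling (+ (3 * m + 1) ℚ./ 2) ℤ.+ floor (+ (3 * Δ + 2 * n) ℚ./ 4)

  i*n≤N⇒i≤N/n : ∀ i N n .{{_ : NonZero n}} → i ℤ.* + n ℤ.≤ + N → i ℤ.≤ + (N / n)
  i*n≤N⇒i≤N/n (+ a)    N n a*n≤N = +≤+ (subst (_≤ N / n) (m*n/n≡m a n)
                                      (/-monoˡ-≤ n (ℤ.drop‿+≤+ (subst (ℤ._≤ + N) (sym (ℤ.pos-* a n)) a*n≤N))))
  i*n≤N⇒i≤N/n -[1+ _ ] _ _ _ = -≤+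

  bracket≤ : ∀ n m Δ → bracket n m Δ ℤ.≤ + ((3 * n + 1) / 2 + (3 * m + 2) / 2 + (3 * Δ + 2 * n) / 4)
  bracket≤ n m Δ = ℤ.+-mono-≤ (ℤ.+-mono-≤
    (i*n≤N⇒i≤N/n a (3 * n + 1) 2 (floor[i/n]*n≤i (+ (3 * n + 1)) 1))
    (i*n≤N⇒i≤N/n b (3 * m + 2) 2 b*2≤3m+2))
    (i*n≤N⇒i≤N/n c (3 * Δ + 2 * n) 4 (floor[i/n]*n≤i (+ (3 * Δ + 2 * n)) 3))
    where
    a = floor (+ (3 * n + 1) ℚ./ 2)
    b = ceiling (+ (3 * m + 1) ℚ./ 2)
    c = floor (+ (3 * Δ + 2 * n) ℚ./ 4)
    b*2≤3m+2 : b ℤ.* + 2 ℤ.≤ + (3 * m + 2)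
    b*2≤3m+2 = subst (b ℤ.* + 2 ℤ.≤_) (ℤ.pred-suc (+ (3 * m + 2))) (ℤ.i<j⇒i≤pred[j]
      (subst (b ℤ.* + 2 ℤ.<_) (cong +_ (assoc m)) (ceiling[i/n]*n<i+n (+ (3 * m + 1)) 1)))
      where
      assoc : ∀ m → 3 * m + 1 + 2 ≡ 1 + (3 * m + 2)
      assoc = solve-∀

  bracket-bound : ∀ n m Δ S → 2 * m ≤ S → Δ + n ≤ suc S → n < S ⊎ (n ≡ 2 × S ≡ 2) →
                  (3 * n + 1) / 2 + (3 * m + 2) / 2 + (3 * Δ + 2 * n) / 4 ≤ 3 * S
  bracket-bound n m Δ S 2m≤S Δ+n≤1+S (inj₁ n<S) = s≤s⁻¹ (*-cancelʳ-< 4 (A + B + C) (suc (3 * S)) (begin-strict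
    (A + B + C) * 4                                   ≡⟨ distrib A B C ⟩
    A * 2 * 2 + B * 2 * 2 + C * 4
      ≤⟨ +-mono-≤ (+-mono-≤ (*-monoˡ-≤ 2 (m/n*n≤m (3 * n + 1) 2)) (*-monoˡ-≤ 2 (m/n*n≤m (3 * m + 2) 2)))
                  (m/n*n≤m (3 * Δ + 2 * n) 4) ⟩
    (3 * n + 1) * 2 + (3 * m + 2) * 2 + (3 * Δ + 2 * n) ≡⟨ regroup n m Δ ⟩
    (5 * n + 6) + 3 * (2 * m) + 3 * (Δ + n)
      ≤⟨ +-mono-≤ (+-mono-≤ 5n+6≤6S (*-monoʳ-≤ 3 2m≤S)) (*-monoʳ-≤ 3 Δ+n≤1+S) ⟩
    6 * S + 3 * S + 3 * suc S                         ≡⟨ collect S ⟩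
    12 * S + 3                                        <⟨ n<1+n _ ⟩
    suc (12 * S + 3)                                  ≡⟨ times4 S ⟩
    suc (3 * S) * 4                                   ∎))
    where
    open ≤-Reasoning
    A = (3 * n + 1) / 2
    B = (3 * m + 2) / 2
    C = (3 * Δ + 2 * n) / 4
    5n+6≤6S : 5 * n + 6 ≤ 6 * S
    5n+6≤6S = begin
      5 * n + 6     ≤⟨ +-monoˡ-≤ 6 (*-monoˡ-≤ n (n≤1+n 5)) ⟩
      6 * n + 6     ≡⟨ +-comm (6 * n) 6 ⟩
      6 + 6 * n     ≡⟨ *-suc 6 n ⟨
      6 * suc n     ≤⟨ *-monoʳ-≤ 6 n<S ⟩
      6 * S         ∎
    distrib : ∀ a b c → (a + b + c) * 4 ≡ a * 2 * 2 + b * 2 * 2 + c * 4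
    distrib = solve-∀
    regroup : ∀ n m Δ → (3 * n + 1) * 2 + (3 * m + 2) * 2 + (3 * Δ + 2 * n) ≡ (5 * n + 6) + 3 * (2 * m) + 3 * (Δ + n)
    regroup = solve-∀
    collect : ∀ S → 6 * S + 3 * S + 3 * suc S ≡ 12 * S + 3
    collect = solve-∀
    times4 : ∀ S → suc (12 * S + 3) ≡ suc (3 * S) * 4
    times4 = solve-∀

  -- For n = 2 the estimate 4 (A + B + C) ≤ 12 S + 3 fails, so the quotients are bounded one by one.
  bracket-bound .2 m Δ .2 2m≤2 Δ+2≤3 (inj₂ (refl , refl)) =
    +-monoʳ-≤ 3 (+-mono-≤ (/-monoˡ-≤ 2 (+-monoˡ-≤ 2 (*-monoʳ-≤ 3 m≤1)))
                          (/-monoˡ-≤ 4 (+-monoˡ-≤ 4 (*-monoʳ-≤ 3 Δ≤1))))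
    where
    m≤1 : m ≤ 1
    m≤1 = *-cancelˡ-≤ 2 2m≤2
    Δ≤1 : Δ ≤ 1
    Δ≤1 = +-cancelʳ-≤ 2 Δ 1 Δ+2≤3

  bracket≤3Σdeg : ∀ {n} .{{_ : NonZero n}} (G : Graph n) → Connected G →
                  Σv (deg G) ≡ 0 ⊎ bracket n (edgeCount G) (maxDeg G) ℤ.≤ + (3 * Σv (deg G))
  -- For n = 1 the bracket is 3 > 3 S = 0, but then λ = 0.
  bracket≤3Σdeg {1}               G _    rewrite irrefl G zero = inj₁ refl
  bracket≤3Σdeg {n@(suc (suc _))} G conn = inj₂ (ℤ.≤-trans (bracket≤ n m Δ) (+≤+ (bracket-bound n m Δ S
    (≤-reflexive (sym (handshake G)))
    (maxDeg+n≤1+Σdeg G (connected⇒1≤deg G conn))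
    (connected⇒n<Σdeg⊎n≡Σdeg≡2 G conn))))
    where
    m = edgeCount G
    Δ = maxDeg G
    S = Σv (deg G)

module RationalBound where

  open import Data.Nat as ℕ using (ℕ; suc)
  import Data.Nat.Properties as ℕ
  open import Data.Integer as ℤ using (ℤ; +_; +≤+)
  import Data.Integer.Properties as ℤ
  open import Data.Rational hiding (NonZero)
  open import Data.Rational.Properties
  import Data.Rational.Unnormalised as ℚᵘ
  import Data.Rational.Unnormalised.Properties as ℚᵘ
  open import Data.Sum using (_⊎_; inj₁; inj₂)
  open import Relation.Binary.PropositionalEquality
  open import Data.Nat.Tactic.RingSolver using (solve-∀)

  toℚᵘ-/ : ∀ i n .{{_ : ℕ.NonZero n}} → toℚᵘ (i / n) ℚᵘ.≃ (i ℚᵘ./ n)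
  toℚᵘ-/ i (suc d) = toℚᵘ-fromℚᵘ (ℚᵘ.mkℚᵘ i d)

  ≤-via-ℚᵘ : ∀ {p q p′ q′} → toℚᵘ p ℚᵘ.≃ p′ → toℚᵘ q ℚᵘ.≃ q′ → p′ ℚᵘ.≤ q′ → p ≤ q
  ≤-via-ℚᵘ p≃p′ q≃q′ p′≤q′ =
    toℚᵘ-cancel-≤ (ℚᵘ.≤-respˡ-≃ (ℚᵘ.≃-sym p≃p′) (ℚᵘ.≤-respʳ-≃ (ℚᵘ.≃-sym q≃q′) p′≤q′))

  [S/n]²*[k/3]≤F : ∀ {n} .{{_ : ℕ.NonZero n}} S F k →
                   + S ℤ.* + S ℤ.* k ℤ.≤ + F ℤ.* + (n ℕ.* n ℕ.* 3) → (+ S / n) * (+ S / n) * (k / 3) ≤ + F / 1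
  [S/n]²*[k/3]≤F {n@(suc _)} S F k S²k≤3n²F = ≤-via-ℚᵘ
    (ℚᵘ.≃-trans (toℚᵘ-homo-* ((+ S / n) * (+ S / n)) (k / 3))
      (ℚᵘ.*-cong (ℚᵘ.≃-trans (toℚᵘ-homo-* (+ S / n) (+ S / n)) (ℚᵘ.*-cong (toℚᵘ-/ (+ S) n) (toℚᵘ-/ (+ S) n)))
                 (toℚᵘ-/ k 3)))
    (toℚᵘ-/ (+ F) 1)
    (ℚᵘ.*≤* (subst (ℤ._≤ _) (sym (ℤ.*-identityʳ _)) S²k≤3n²F))

  S²*k≤F*n²*3 : ∀ n S F (k : ℤ) → S ≡ 0 ⊎ k ℤ.≤ + (3 ℕ.* S) → S ℕ.* S ℕ.* S ℕ.≤ F ℕ.* (n ℕ.* n) →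
                + S ℤ.* + S ℤ.* k ℤ.≤ + F ℤ.* + (n ℕ.* n ℕ.* 3)
  S²*k≤F*n²*3 n .0 F k (inj₁ refl) _ = subst (+ 0 ℤ.≤_) (ℤ.pos-* F (n ℕ.* n ℕ.* 3)) (+≤+ ℕ.z≤n)
  S²*k≤F*n²*3 n S F k (inj₂ k≤3S) S³≤Fn² = begin
    + S ℤ.* + S ℤ.* k               ≡⟨ cong (ℤ._* k) (ℤ.pos-* S S) ⟨
    + (S ℕ.* S) ℤ.* k               ≤⟨ ℤ.*-monoˡ-≤-nonNeg (+ (S ℕ.* S)) k≤3S ⟩
    + (S ℕ.* S) ℤ.* + (3 ℕ.* S)     ≡⟨ ℤ.pos-* (S ℕ.* S) (3 ℕ.* S) ⟨
    + (S ℕ.* S ℕ.* (3 ℕ.* S))       ≤⟨ +≤+ S²*3S≤F*n²*3 ⟩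
    + (F ℕ.* (n ℕ.* n ℕ.* 3))       ≡⟨ ℤ.pos-* F (n ℕ.* n ℕ.* 3) ⟩
    + F ℤ.* + (n ℕ.* n ℕ.* 3)       ∎
    where
    open ℤ.≤-Reasoning
    S²*3S≤F*n²*3 : S ℕ.* S ℕ.* (3 ℕ.* S) ℕ.≤ F ℕ.* (n ℕ.* n ℕ.* 3)
    S²*3S≤F*n²*3 = ℕ.≤-trans (ℕ.≤-reflexive (rearrange S))
      (ℕ.≤-trans (ℕ.*-monoʳ-≤ 3 S³≤Fn²) (ℕ.≤-reflexive (rearrange′ F (n ℕ.* n))))
      where
      rearrange : ∀ S → S ℕ.* S ℕ.* (3 ℕ.* S) ≡ 3 ℕ.* (S ℕ.* S ℕ.* S)
      rearrange = solve-∀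
      rearrange′ : ∀ F N → 3 ℕ.* (F ℕ.* N) ≡ F ℕ.* (N ℕ.* 3)
      rearrange′ = solve-∀

  [S/n]²[k/3]-F+r≤s : ∀ {n} .{{_ : ℕ.NonZero n}} S F s r (k : ℤ) →
                      S ≡ 0 ⊎ k ℤ.≤ + (3 ℕ.* S) → S ℕ.* S ℕ.* S ℕ.≤ F ℕ.* (n ℕ.* n) → r ℕ.≤ s →
                      (+ S / n) * (+ S / n) * (k / 3) - + F / 1 + + r / 1 ≤ + s / 1
  [S/n]²[k/3]-F+r≤s {n} S F s r k S≡0⊎k≤3S S³≤Fn² r≤s = begin
    X - F′ + r′      ≤⟨ +-monoˡ-≤ r′ (+-monoˡ-≤ (- F′) X≤F′) ⟩
    F′ - F′ + r′     ≡⟨ cong (_+ r′) (+-inverseʳ F′) ⟩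
    0ℚ + r′          ≡⟨ +-identityˡ r′ ⟩
    r′               ≤⟨ ≤-via-ℚᵘ (toℚᵘ-/ (+ r) 1) (toℚᵘ-/ (+ s) 1) (ℚᵘ.*≤* (ℤ.*-monoʳ-≤-nonNeg (+ 1) (+≤+ r≤s))) ⟩
    + s / 1          ∎
    where
    open ≤-Reasoning
    X = (+ S / n) * (+ S / n) * (k / 3)
    F′ = + F / 1
    r′ = + r / 1
    X≤F′ : X ≤ F′
    X≤F′ = [S/n]²*[k/3]≤F S F k (S²*k≤F*n²*3 n S F k S≡0⊎k≤3S S³≤Fn²)

open import Defs
open import Data.Nat as ℕ using (ℕ; NonZero)
open import Data.Integer as ℤ using (ℤ; +_)
open import Data.Rational using (ℚ; _/_; _≥_; _+_; _-_; _*_; floor; ceiling)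
open import Data.Product using (_,_)
open Degrees using (cube[Σv]≤Σv[cube]*n²; irr≤sigma)
open Bracket using (bracket; bracket≤3Σdeg)
open RationalBound using ([S/n]²[k/3]-F+r≤s)

lemma5 : ∀ {n : ℕ} .{{_ : NonZero n}} (T : Graph n) → IsTree T →
    let m = edgeCount T
        Δ = maxDeg T
        λD = (+ Σv (deg T)) / n
    in (+ sigma T) / 1 ≥
         ((λD * λD) * ((floor ((+ (3 ℕ.* n ℕ.+ 1)) / 2)
                         ℤ.+ ceiling ((+ (3 ℕ.* m ℕ.+ 1)) / 2)
                         ℤ.+ floor ((+ (3 ℕ.* Δ ℕ.+ 2 ℕ.* n)) / 4)) / 3))
         - (+ Σv (λ v → deg T v ℕ.* deg T v ℕ.* deg T v)) / 1
         + (+ irr T) / 1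
lemma5 {n} T (connected , _) =
  [S/n]²[k/3]-F+r≤s (Σv (deg T)) (Σv (λ v → deg T v ℕ.* deg T v ℕ.* deg T v)) (sigma T) (irr T)
    (bracket n (edgeCount T) (maxDeg T))
    (bracket≤3Σdeg T connected) (cube[Σv]≤Σv[cube]*n² (deg T)) (irr≤sigma T)
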